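{- Let $n,k,t$ be positive integers with $k>t$ and $n\ge t+\frac12(k+1-t)(k-t)$. Define $f:\{r\in\mathbb{Z}: 0\le r\le t-1\}\to\mathbb{R}$ by $$f(r)=\binom{k-r}{t-r}\binom{n-2t+r}{k-2t+r}.$$ Then $f$ is monotone increasing, i.e. $f(r)\le f(r+1)$ for all integers $0\le r\le t-2$.
   Context: Binomial coefficients follow the convention $\binom{a}{b}=0$ whenever $b<0$ or $b>a$. -}

module Defs where

open import Data.Nat using (ℕ; _≤ᵇ_)
open import Data.Nat.Combinatorics using (_C_)
open import Data.Integer using (ℤ; +_; -[1+_])

-- Binomial coefficient with integer arguments, using the convention
-- binom a b = 0 whenever b < 0 or b > a (in particular when a < 0 ≤ b).
-- For 0 ≤ b, 0 ≤ a, the stdlib's  a C b  already is 0 when b > a.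
binomℤ : ℤ → ℤ → ℕ
binomℤ a        -[1+ _ ] = 0
binomℤ -[1+ _ ] (+ _)    = 0
binomℤ (+ a)    (+ b)    = a C b

f : ℕ → ℕ → ℕ → ℕ → ℕ
f n k t r = let open Data.Integer using (_+_; _-_; _*_) in
  binomℤ ((+ k) - (+ r)) ((+ t) - (+ r))
  Data.Nat.* binomℤ ((+ n) - (+ 2) * (+ t) + (+ r)) ((+ k) - (+ 2) * (+ t) + (+ r))

-- Put b = t − r ≥ 2, e = k − t and m = n − k, so that f(r) = C(e+b, b) · C(m+e−b, e−b).
-- If e < b the second factor vanishes. Otherwise, with j = e − b, the absorption identity
-- (k+1) C(n+1, k+1) = (n+1) C(n, k) reduces f(r) ≤ f(r+1) to (e+b)(j+1) ≤ b(m+j+1).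
-- The hypothesis on n says exactly e(e−1) ≤ 2m, and together with 2(j+1) ≤ b(e−1)
-- this gives e(j+1) ≤ bm, hence the claim.
module Submission where

open import Data.Integer as ℤ using (_⊖_)
open import Data.Integer.Properties using ([+m]-[+n]≡m⊖n; pos-*; distribˡ-⊖-+-pos; ⊖-≥; ⊖-<)
open import Data.List using ([]; _∷_)
open import Data.Nat using (ℕ; zero; suc; _+_; _*_; _∸_; _≤_; _<_; z≤n; s≤s; _≤?_)
open import Data.Nat.Combinatorics using (_C_; nCk+nC[k+1]≡[n+1]C[k+1]; k>n⇒nCk≡0)
open import Data.Nat.Properties
open import Data.Nat.Tactic.RingSolver using (solve)
open import Function.Base using (case_of_)
open import Relation.Binary.PropositionalEquality
open import Relation.Nullary using (yes; no)

open import Defs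

mutual
  [k+1]*[n+1]C[k+1]≡[n+1]*nCk : ∀ n k → suc k * (suc n C suc k) ≡ suc n * (n C k)
  [k+1]*[n+1]C[k+1]≡[n+1]*nCk zero zero    = refl
  [k+1]*[n+1]C[k+1]≡[n+1]*nCk zero (suc k) = begin
    suc (suc k) * (1 C suc (suc k)) ≡⟨ cong (suc (suc k) *_) (k>n⇒nCk≡0 {1} {suc (suc k)} (s≤s (s≤s z≤n))) ⟩
    suc (suc k) * 0                 ≡⟨ *-zeroʳ (suc (suc k)) ⟩
    0                               ≡⟨ cong (1 *_) (k>n⇒nCk≡0 {0} {suc k} (s≤s z≤n)) ⟨
    1 * (0 C suc k)                 ∎
    where open ≡-Reasoning
  [k+1]*[n+1]C[k+1]≡[n+1]*nCk (suc n) k = begin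
    suc k * (suc (suc n) C suc k)                    ≡⟨ cong (suc k *_) (nCk+nC[k+1]≡[n+1]C[k+1] (suc n) k) ⟨
    suc k * (suc n C k + suc n C suc k)              ≡⟨ *-distribˡ-+ (suc k) (suc n C k) _ ⟩
    suc k * (suc n C k) + suc k * (suc n C suc k)    ≡⟨ cong (suc k * (suc n C k) +_) ([k+1]*[n+1]C[k+1]≡[n+1]*nCk n k) ⟩
    suc k * (suc n C k) + suc n * (n C k)            ≡⟨ +-assoc (suc n C k) _ _ ⟩
    suc n C k + (k * (suc n C k) + suc n * (n C k))  ≡⟨ cong (suc n C k +_) (k*[n+1]Ck+[n+1]*nCk≡[n+1]*[n+1]Ck n k) ⟩
    suc (suc n) * (suc n C k)                        ∎
    where open ≡-Reasoning

  k*[n+1]Ck+[n+1]*nCk≡[n+1]*[n+1]Ck : ∀ n k → k * (suc n C k) + suc n * (n C k) ≡ suc n * (suc n C k)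
  k*[n+1]Ck+[n+1]*nCk≡[n+1]*[n+1]Ck n zero    = refl
  k*[n+1]Ck+[n+1]*nCk≡[n+1]*[n+1]Ck n (suc k) = begin
    suc k * (suc n C suc k) + suc n * (n C suc k) ≡⟨ cong (_+ suc n * (n C suc k)) ([k+1]*[n+1]C[k+1]≡[n+1]*nCk n k) ⟩
    suc n * (n C k) + suc n * (n C suc k)         ≡⟨ *-distribˡ-+ (suc n) (n C k) _ ⟨
    suc n * (n C k + n C suc k)                   ≡⟨ cong (suc n *_) (nCk+nC[k+1]≡[n+1]C[k+1] n k) ⟩
    suc n * (suc n C suc k)                       ∎
    where open ≡-Reasoning

cross-multiply-≤ : ∀ {a b m j p x q y} →
                   suc b * p ≡ suc a * x → suc j * q ≡ suc m * y →
                   suc a * suc j ≤ suc m * suc b → p * y ≤ x * q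
cross-multiply-≤ {a} {b} {m} {j} {p} {x} {q} {y} bp≡ax jq≡my ratio =
  *-cancelʳ-≤ (p * y) (x * q) (suc b * suc j) (begin
    p * y * (suc b * suc j)  ≡⟨ solve (b ∷ j ∷ p ∷ y ∷ []) ⟩
    suc b * p * (suc j * y)  ≡⟨ cong (_* (suc j * y)) bp≡ax ⟩
    suc a * x * (suc j * y)  ≡⟨ solve (a ∷ j ∷ x ∷ y ∷ []) ⟩
    suc a * suc j * (x * y)  ≤⟨ *-monoˡ-≤ (x * y) ratio ⟩
    suc m * suc b * (x * y)  ≡⟨ solve (m ∷ b ∷ x ∷ y ∷ []) ⟩
    x * (suc m * y) * suc b  ≡⟨ cong (λ z → x * z * suc b) jq≡my ⟨
    x * (suc j * q) * suc b  ≡⟨ solve (b ∷ j ∷ x ∷ q ∷ []) ⟩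
    x * q * (suc b * suc j)  ∎)
  where open ≤-Reasoning

[1+a]C[1+b]*mCj≤aCb*[1+m]C[1+j] : ∀ a b m j → suc a * suc j ≤ suc m * suc b →
                                   (suc a C suc b) * (m C j) ≤ (a C b) * (suc m C suc j)
[1+a]C[1+b]*mCj≤aCb*[1+m]C[1+j] a b m j =
  cross-multiply-≤ {a} {b} {m} {j} ([k+1]*[n+1]C[k+1]≡[n+1]*nCk a b) ([k+1]*[n+1]C[k+1]≡[n+1]*nCk m j)

m+n≡o⇒o⊖n≡+m : ∀ {m} n {o} → m + n ≡ o → o ⊖ n ≡ ℤ.+ m
m+n≡o⇒o⊖n≡+m {m} n refl = trans (⊖-≥ (m≤n+m n m)) (cong ℤ.+_ (m+n∸n≡m m n))

binomℤ-⊖-< : ∀ x {m n} → m < n → binomℤ x (m ⊖ n) ≡ 0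
binomℤ-⊖-< x {m} {n} m<n rewrite ⊖-< m<n with n ∸ m | m<n⇒0<n∸m m<n
... | suc _ | _ = refl

f≡binomℤ⊖ : ∀ n k t r →
            f n k t r ≡ binomℤ (k ⊖ r) (t ⊖ r) * binomℤ ((n + r) ⊖ (2 * t)) ((k + r) ⊖ (2 * t))
f≡binomℤ⊖ n k t r =
  cong₂ _*_ (cong₂ binomℤ ([+m]-[+n]≡m⊖n k r) ([+m]-[+n]≡m⊖n t r))
            (cong₂ binomℤ (+m-2t+r≡[m+r]⊖2t n) (+m-2t+r≡[m+r]⊖2t k))
  where
    open ≡-Reasoning
    +m-2t+r≡[m+r]⊖2t : ∀ m → ℤ.+ m ℤ.- ℤ.+ 2 ℤ.* ℤ.+ t ℤ.+ ℤ.+ r ≡ (m + r) ⊖ (2 * t)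
    +m-2t+r≡[m+r]⊖2t m = begin
      ℤ.+ m ℤ.- ℤ.+ 2 ℤ.* ℤ.+ t ℤ.+ ℤ.+ r  ≡⟨ cong (λ i → ℤ.+ m ℤ.- i ℤ.+ ℤ.+ r) (pos-* 2 t) ⟨
      ℤ.+ m ℤ.- ℤ.+ (2 * t) ℤ.+ ℤ.+ r      ≡⟨ cong (ℤ._+ ℤ.+ r) ([+m]-[+n]≡m⊖n m (2 * t)) ⟩
      m ⊖ (2 * t) ℤ.+ ℤ.+ r                ≡⟨ distribˡ-⊖-+-pos r m (2 * t) ⟩
      (m + r) ⊖ (2 * t)                    ∎

f≡C*C : ∀ {n k t r a b m j} → a + r ≡ k → b + r ≡ t → m + 2 * t ≡ n + r → j + 2 * t ≡ k + r →
        f n k t r ≡ (a C b) * (m C j)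
f≡C*C {n} {k} {t} {r} {a} {b} {m} {j} a+r≡k b+r≡t m+2t≡n+r j+2t≡k+r = trans (f≡binomℤ⊖ n k t r)
  (cong₂ _*_ (cong₂ binomℤ (m+n≡o⇒o⊖n≡+m {a} r a+r≡k) (m+n≡o⇒o⊖n≡+m {b} r b+r≡t))
             (cong₂ binomℤ (m+n≡o⇒o⊖n≡+m {m} (2 * t) m+2t≡n+r) (m+n≡o⇒o⊖n≡+m {j} (2 * t) j+2t≡k+r)))

k+r<2t⇒f≡0 : ∀ {n k t r} → k + r < 2 * t → f n k t r ≡ 0
k+r<2t⇒f≡0 {n} {k} {t} {r} k+r<2t = trans (f≡binomℤ⊖ n k t r)
  (trans (cong (binomℤ (k ⊖ r) (t ⊖ r) *_) (binomℤ-⊖-< ((n + r) ⊖ (2 * t)) k+r<2t))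
         (*-zeroʳ (binomℤ (k ⊖ r) (t ⊖ r))))

f≤f[1+r]-by-ratio : ∀ {n k t r a b m j} →
                    suc a + r ≡ k → suc b + r ≡ t → m + 2 * t ≡ n + r → j + 2 * t ≡ k + r →
                    suc a * suc j ≤ suc m * suc b → f n k t r ≤ f n k t (suc r)
f≤f[1+r]-by-ratio {n} {k} {t} {r} {a} {b} {m} {j} a+r≡k b+r≡t m+2t≡n+r j+2t≡k+r ratio =
  subst₂ _≤_ (sym (f≡C*C {a = suc a} {suc b} {m} {j} a+r≡k b+r≡t m+2t≡n+r j+2t≡k+r))
             (sym (f≡C*C {a = a} {b} {suc m} {suc j} (trans (+-suc a r) a+r≡k) (trans (+-suc b r) b+r≡t)
                         (trans (cong suc m+2t≡n+r) (sym (+-suc n r)))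
                         (trans (cong suc j+2t≡k+r) (sym (+-suc k r)))))
    ([1+a]C[1+b]*mCj≤aCb*[1+m]C[1+j] a b m j ratio)

Admissible : ℕ → ℕ → ℕ → Set
Admissible n k t = 2 * t + (k + 1 ∸ t) * (k ∸ t) ≤ 2 * n

Admissible⇒k≤n : ∀ {n k t} → t < k → Admissible n k t → k ≤ n
Admissible⇒k≤n {n} {k} {t} t<k admissible = *-cancelˡ-≤ 2 (begin
  2 * k                          ≡⟨ cong (2 *_) (m+[n∸m]≡n (<⇒≤ t<k)) ⟨
  2 * (t + (k ∸ t))              ≡⟨ *-distribˡ-+ 2 t (k ∸ t) ⟩
  2 * t + 2 * (k ∸ t)            ≤⟨ +-monoʳ-≤ (2 * t) (*-monoˡ-≤ (k ∸ t) 2≤k+1∸t) ⟩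
  2 * t + (k + 1 ∸ t) * (k ∸ t)  ≤⟨ admissible ⟩
  2 * n                          ∎)
  where
    open ≤-Reasoning
    2≤k+1∸t : 2 ≤ k + 1 ∸ t
    2≤k+1∸t = m+n≤o⇒m≤o∸n 2 (subst (2 + t ≤_) (+-comm 1 k) (s≤s t<k))

Admissible⇒[e+1]e≤2[e+m] : ∀ t e m → Admissible (t + e + m) (t + e) t → (e + 1) * e ≤ 2 * (e + m)
Admissible⇒[e+1]e≤2[e+m] t e m admissible = +-cancelˡ-≤ (2 * t) _ _
  (subst₂ _≤_ (cong₂ (λ x y → 2 * t + x * y) t+e+1∸t≡e+1 (m+n∸m≡n t e))
              2[t+e+m]≡2t+2[e+m]
              admissible)
  where
    2[t+e+m]≡2t+2[e+m] : 2 * (t + e + m) ≡ 2 * t + 2 * (e + m)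
    2[t+e+m]≡2t+2[e+m] = solve (t ∷ e ∷ m ∷ [])
    t+e+1∸t≡e+1 : t + e + 1 ∸ t ≡ e + 1
    t+e+1∸t≡e+1 = trans (cong (_∸ t) (+-assoc t e 1)) (m+n∸m≡n t (e + 1))

ratio-bound : ∀ {b} j m → 2 ≤ b → (b + j + 1) * (b + j) ≤ 2 * (b + j + m) →
              (b + j + b) * suc j ≤ suc (m + j) * b
ratio-bound {b@(suc (suc c))} j m (s≤s (s≤s z≤n)) [e+1]e≤2[e+m] = begin
  (b + j + b) * suc j          ≡⟨ solve (c ∷ j ∷ []) ⟩
  b * suc j + (b + j) * suc j  ≤⟨ +-monoʳ-≤ (b * suc j) e[j+1]≤bm ⟩
  b * suc j + b * m            ≡⟨ solve (c ∷ j ∷ m ∷ []) ⟩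
  suc (m + j) * b              ∎
  where
    open ≤-Reasoning
    [e+1]e≡2e+[e-1]e : (b + j + 1) * (b + j) ≡ 2 * (b + j) + (suc c + j) * (b + j)
    [e+1]e≡2e+[e-1]e = solve (c ∷ j ∷ [])
    2[e+m]≡2e+2m : 2 * (b + j + m) ≡ 2 * (b + j) + 2 * m
    2[e+m]≡2e+2m = solve (c ∷ j ∷ m ∷ [])
    [e-1]e≤2m : (suc c + j) * (b + j) ≤ 2 * m
    [e-1]e≤2m = +-cancelˡ-≤ (2 * (b + j)) ((suc c + j) * (b + j)) (2 * m)
                  (subst₂ _≤_ [e+1]e≡2e+[e-1]e 2[e+m]≡2e+2m [e+1]e≤2[e+m])
    2[j+1]≤b[e-1] : 2 * suc j ≤ b * (suc c + j)
    2[j+1]≤b[e-1] = *-mono-≤ (s≤s (s≤s (z≤n {c}))) (s≤s (m≤n+m j c))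
    e[j+1]≤bm : (b + j) * suc j ≤ b * m
    e[j+1]≤bm = *-cancelˡ-≤ 2 (begin
      2 * ((b + j) * suc j)       ≡⟨ solve (c ∷ j ∷ []) ⟩
      (b + j) * (2 * suc j)       ≤⟨ *-monoʳ-≤ (b + j) 2[j+1]≤b[e-1] ⟩
      (b + j) * (b * (suc c + j)) ≡⟨ solve (c ∷ j ∷ []) ⟩
      b * ((suc c + j) * (b + j)) ≤⟨ *-monoʳ-≤ b [e-1]e≤2m ⟩
      b * (2 * m)                 ≡⟨ solve (c ∷ m ∷ []) ⟩
      2 * (b * m)                 ∎)

e<b⇒k+r<2t : ∀ {k t r b e} → r + b ≡ t → t + e ≡ k → e < b → k + r < 2 * t
e<b⇒k+r<2t {r = r} {b} {e} refl refl e<b = begin-strict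
  r + b + e + r      ≡⟨ solve (r ∷ b ∷ e ∷ []) ⟩
  (r + b + r) + e    <⟨ +-monoʳ-< (r + b + r) e<b ⟩
  (r + b + r) + b    ≡⟨ solve (r ∷ b ∷ []) ⟩
  2 * (r + b)        ∎
  where open ≤-Reasoning

f≤f[1+r] : ∀ {n k t r b e j m} → 2 ≤ b → r + b ≡ t → t + e ≡ k → b + j ≡ e → k + m ≡ n →
           Admissible n k t → f n k t r ≤ f n k t (suc r)
f≤f[1+r] {r = r} {b@(suc (suc c))} {j = j} {m} 2≤b@(s≤s (s≤s z≤n)) refl refl refl refl admissible =
  f≤f[1+r]-by-ratio {a = suc c + j + b} {suc c} {m + j} {j} a+r≡k (+-comm b r) m+2t≡n+r j+2t≡k+r
    (ratio-bound j m 2≤b (Admissible⇒[e+1]e≤2[e+m] (r + b) (b + j) m admissible))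
  where
    a+r≡k : b + j + b + r ≡ r + b + (b + j)
    a+r≡k = solve (r ∷ c ∷ j ∷ [])
    m+2t≡n+r : m + j + 2 * (r + b) ≡ r + b + (b + j) + m + r
    m+2t≡n+r = solve (r ∷ c ∷ j ∷ m ∷ [])
    j+2t≡k+r : j + 2 * (r + b) ≡ r + b + (b + j) + r
    j+2t≡k+r = solve (r ∷ c ∷ j ∷ [])

lemma2p6 : (n k t : ℕ) → 0 < n → 0 < t → t < k →
           2 * t + (k + 1 ∸ t) * (k ∸ t) ≤ 2 * n →
           (r : ℕ) → suc r ≤ t ∸ 1 →
           f n k t r ≤ f n k t (suc r)
lemma2p6 n k t _ 0<t t<k admissible r r+1≤t∸1 = case t ∸ r ≤? k ∸ t of λ where
    (yes t∸r≤k∸t) → f≤f[1+r] 2≤t∸r r+[t∸r]≡t t+[k∸t]≡k (m+[n∸m]≡n t∸r≤k∸t)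
                      (m+[n∸m]≡n (Admissible⇒k≤n t<k admissible)) admissible
    (no t∸r≰k∸t)  → subst (_≤ f n k t (suc r))
                      (sym (k+r<2t⇒f≡0 {n} {k} {t} {r} (e<b⇒k+r<2t r+[t∸r]≡t t+[k∸t]≡k (≰⇒> t∸r≰k∸t))))
                      z≤n
  where
    2+r≤t : 2 + r ≤ t
    2+r≤t = subst (_≤ t) (+-comm (suc r) 1) (m≤o∸n⇒m+n≤o (suc r) 0<t r+1≤t∸1)
    2≤t∸r : 2 ≤ t ∸ r
    2≤t∸r = m+n≤o⇒m≤o∸n 2 2+r≤t
    r+[t∸r]≡t : r + (t ∸ r) ≡ t
    r+[t∸r]≡t = m+[n∸m]≡n (≤-trans (m≤n+m r 2) 2+r≤t)
    t+[k∸t]≡k : t + (k ∸ t) ≡ k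
    t+[k∸t]≡k = m+[n∸m]≡n (<⇒≤ t<k)
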